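{- Let $G$ be a graph and $A\subseteq RN(G)$. Then $A\in\mathcal{D}_{RN}(G)$ if and only if every $a\in A$ satisfies $Priv_{IR}(A,a)\neq\emptyset$, and there exists $I\subseteq IR(G)$ such that $I$ dominates $IR(G)\setminus N(A)$ but $I$ does not dominate $Priv_{IR}(A,a)$ for any $a\in A$. Furthermore, such a set $I$ that is inclusion-minimal with this property satisfies that $A\cup I$ is a minimal dominating set of $G$.
   Context: All graphs are finite, simple and undirected. $N(x)$, $N[x]=N(x)\cup\{x\}$ are the open and closed neighbourhoods; for $X\subseteq V(G)$, $N[X]=\bigcup_{x\in X}N[x]$ and $N(X)=N[X]\setminus X$. $D$ dominates $X$ if $X\subseteq N[D]$; a minimal dominating set of $G$ is an inclusion-minimal set dominating $V(G)$. A vertex $x$ is irredundant if $N[x]$ is inclusion-minimal in $\{N[y]:y\in V(G)\}$, with the convention that among several vertices having the same inclusion-minimal closed neighbourhood exactly one (fixed) is declared irredundant; all other vertices are redundant. $IR(G)$, $RN(G)$ are the sets of irredundant and redundant vertices. For $D\subseteq V(G)$ and $x\in D$, a private neighbour of $x$ w.r.t. $D$ is a vertex $u$ with $N[u]\cap D=\{x\}$ (possibly $u=x$); $Priv_{IR}(D,x)$ is the set of such private neighbours lying in $IR(G)$. $\mathcal{D}_{RN}(G)=\{D\cap RN(G): D\text{ a minimal dominating set of }G\}$. -}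

module Defs where

open import Data.Nat using (ℕ)
open import Data.Bool using (Bool; true; false; _∨_)
open import Data.Fin using (Fin; _≟_)
open import Data.Fin.Subset using (Subset; _∈_; _∉_; _⊆_; _⊂_; _∩_; _∪_; ∁; ⁅_⁆)
open import Data.Vec using (tabulate)
open import Data.Product using (Σ; ∃; ∃-syntax; _×_)
open import Relation.Nullary using (¬_)
open import Relation.Nullary.Decidable using (⌊_⌋)
open import Relation.Binary.PropositionalEquality using (_≡_)

record Graph (n : ℕ) : Set where
  field
    adj     : Fin n → Fin n → Bool
    symm    : ∀ x y → adj x y ≡ adj y x
    irrefl  : ∀ x → adj x x ≡ false
open Graph public

module _ {n : ℕ} (G : Graph n) where

  N[_] : Fin n → Subset n
  N[ x ] = tabulate (λ y → ⌊ x ≟ y ⌋ ∨ adj G x y)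

  InClosedNbhdOf : Subset n → Fin n → Set
  InClosedNbhdOf D u = ∃[ x ] (x ∈ D × u ∈ N[ x ])

  InOpenNbhdOf : Subset n → Fin n → Set
  InOpenNbhdOf D u = InClosedNbhdOf D u × u ∉ D

  Dominates : Subset n → (Fin n → Set) → Set
  Dominates D X = ∀ u → X u → InClosedNbhdOf D u

  DominatingSet : Subset n → Set
  DominatingSet D = Dominates D (λ _ → Fin n)

  MinimalDominatingSet : Subset n → Set
  MinimalDominatingSet D =
    DominatingSet D × (∀ D′ → D′ ⊂ D → ¬ DominatingSet D′)

  HasMinimalClosedNbhd : Fin n → Set
  HasMinimalClosedNbhd x = ∀ y → N[ y ] ⊆ N[ x ] → N[ y ] ≡ N[ x ]

  -- A fixed choice of irredundant vertices: exactly one vertex of each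
  -- inclusion-minimal closed neighbourhood is declared irredundant.
  record IRChoice : Set where
    field
      IR        : Subset n
      IR-min    : ∀ x → x ∈ IR → HasMinimalClosedNbhd x
      IR-cover  : ∀ x → HasMinimalClosedNbhd x → ∃[ y ] (y ∈ IR × N[ y ] ≡ N[ x ])
      IR-unique : ∀ x y → x ∈ IR → y ∈ IR → N[ x ] ≡ N[ y ] → x ≡ y

  module _ (C : IRChoice) where
    open IRChoice C

    RN : Subset n
    RN = ∁ IR

    PrivIR : Subset n → Fin n → Fin n → Set
    PrivIR D x u = u ∈ IR × (N[ u ] ∩ D ≡ ⁅ x ⁆)

    InDRN : Subset n → Set
    InDRN A = ∃[ D ] (MinimalDominatingSet D × D ∩ RN ≡ A)

    GoodI : Subset n → Subset n → Set
    GoodI A I =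
      I ⊆ IR
      × Dominates I (λ u → u ∈ IR × ¬ InOpenNbhdOf A u)
      × (∀ a → a ∈ A → ¬ Dominates I (PrivIR A a))

    MinimalGoodI : Subset n → Subset n → Set
    MinimalGoodI A I = GoodI A I × (∀ J → J ⊂ I → ¬ GoodI A J)

module Submission where

-- Two facts about irredundant vertices drive everything:
--   * every closed neighbourhood N[v] contains N[w] for some irredundant w
--     (take an inclusion-minimal closed neighbourhood inside N[v]), hence a set
--     dominating IR(G) dominates G;
--   * consequently every vertex a of a minimal dominating set D has an
--     irredundant private neighbour, i.e. some w ∈ IR(G) with N[w] ∩ D = {a}.
-- Necessity: for a minimal dominating D with D ∩ RN(G) = A, the set I = D ∩ IR(G)
-- is the required witness, and the private neighbours of the a ∈ A are those
-- of D.  Sufficiency: A ∪ I dominates G; a minimal dominating D ⊆ A ∪ I must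
-- contain every a ∈ A, since some private neighbour of a is not dominated by I.
-- Minimality: deleting a vertex of A from A ∪ I would make I dominate the private
-- neighbours of a, and deleting vertices of I would give a smaller witness.

open import Defs
open import Data.Nat using (ℕ; suc; _<_; s≤s)
open import Data.Nat.Properties using (≤-refl; <-≤-trans)
open import Data.Bool using (true; _∨_)
import Data.Bool.Properties as Bool
open import Data.Fin using (Fin; _≟_)
open import Data.Fin.Properties using (any?; all?)
open import Data.Fin.Subset using (Subset; _∈_; _∉_; _⊆_; _⊂_; _∪_; _∩_; ∁; ⁅_⁆; ∣_∣)
open import Data.Fin.Subset.Properties
  using (_∈?_; _⊆?_; _⊂?_; anySubset?; p⊂q⇒∣p∣<∣q∣; ⊆-antisym; ⊆-trans; x∈⁅x⁆; x∈⁅y⁆⇒x≡y;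
         x∈∁p⇒x∉p; x∉p⇒x∈∁p; p∩q⊆p; p∩q⊆q; x∈p∩q⁺; x∈p∪q⁺; x∈p∪q⁻)
open import Data.Vec using (lookup)
open import Data.Vec.Properties using (lookup∘tabulate; []=⇒lookup; lookup⇒[]=; ≡-dec)
open import Data.Product using (∃-syntax; _×_; _,_; proj₁)
open import Data.Sum using (_⊎_; inj₁; inj₂)
open import Data.Empty using (⊥-elim)
open import Relation.Nullary using (¬_; Dec; yes; no)
open import Relation.Nullary.Decidable
  using (⌊_⌋; _×-dec_; ¬?; decidable-stable; isYes≗does; does-⇔)
open import Relation.Unary using (Decidable)
open import Relation.Binary.PropositionalEquality using (_≡_; refl; sym; trans; cong₂; subst; module ≡-Reasoning)
open import Function using (_∘_; case_of_)
open import Function.Bundles using (_⇔_; mk⇔)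

minimal-subset-below : ∀ {n} (P : Subset n → Set) → Decidable P
  → ∀ k (S : Subset n) → ∣ S ∣ < k → P S
  → ∃[ T ] (T ⊆ S × P T × (∀ T′ → T′ ⊂ T → ¬ P T′))
minimal-subset-below P P? (suc k) S (s≤s ∣S∣≤k) PS
  with anySubset? (λ T → (T ⊂? S) ×-dec P? T)
... | no no-smaller = S , (λ x → x) , PS , λ T′ T′⊂S PT′ → no-smaller (T′ , T′⊂S , PT′)
... | yes (T , T⊂S , PT)
  with minimal-subset-below P P? k T (<-≤-trans (p⊂q⇒∣p∣<∣q∣ T⊂S) ∣S∣≤k) PT
... | U , U⊆T , PU , U-min = U , ⊆-trans U⊆T (proj₁ T⊂S) , PU , U-min

minimal-subset : ∀ {n} (P : Subset n → Set) → Decidable P → (S : Subset n) → P S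
  → ∃[ T ] (T ⊆ S × P T × (∀ T′ → T′ ⊂ T → ¬ P T′))
minimal-subset P P? S = minimal-subset-below P P? (suc ∣ S ∣) S (s≤s ≤-refl)

module _ {n : ℕ} (G : Graph n) where

  N : Fin n → Subset n
  N x = N[_] G x

  ∈N-sym : ∀ {x u} → u ∈ N x → x ∈ N u
  ∈N-sym {x} {u} u∈Nx = lookup⇒[]= x (N u) (begin
      lookup (N u) x              ≡⟨ lookup∘tabulate _ x ⟩
      ⌊ u ≟ x ⌋ ∨ adj G u x       ≡⟨ cong₂ _∨_ ≟-sym (symm G u x) ⟩
      ⌊ x ≟ u ⌋ ∨ adj G x u       ≡⟨ sym (lookup∘tabulate _ u) ⟩
      lookup (N x) u              ≡⟨ []=⇒lookup u∈Nx ⟩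
      true                        ∎)
    where
      open ≡-Reasoning
      ≟-sym : ⌊ u ≟ x ⌋ ≡ ⌊ x ≟ u ⌋
      ≟-sym = trans (isYes≗does (u ≟ x))
                (trans (does-⇔ (mk⇔ sym sym) (u ≟ x) (x ≟ u)) (sym (isYes≗does (x ≟ u))))

  dominated? : ∀ D u → Dec (InClosedNbhdOf G D u)
  dominated? D u = any? (λ x → (x ∈? D) ×-dec (u ∈? N x))

  dominating? : Decidable (DominatingSet G)
  dominating? D with all? (dominated? D)
  ... | yes all-dominated = yes (λ u _ → all-dominated u)
  ... | no  some-not      = no (λ dom → some-not (λ u → dom u u))

  dominated-mono : ∀ {D D′ u} → D ⊆ D′ → InClosedNbhdOf G D u → InClosedNbhdOf G D′ u
  dominated-mono D⊆D′ (x , x∈D , u∈Nx) = x , D⊆D′ x∈D , u∈Nx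

  undominated-witness : ∀ {D} {X : Fin n → Set} → Decidable X → ¬ Dominates G D X
    → ∃[ u ] (X u × ¬ InClosedNbhdOf G D u)
  undominated-witness {D} X? ¬dom
    with any? (λ u → X? u ×-dec ¬? (dominated? D u))
  ... | yes witness = witness
  ... | no  none    =
    ⊥-elim (¬dom (λ u Xu → decidable-stable (dominated? D u) (λ ¬du → none (u , Xu , ¬du))))

  private-unique : ∀ {D a u z} → N u ∩ D ≡ ⁅ a ⁆ → z ∈ N u → z ∈ D → z ≡ a
  private-unique {a = a} {z = z} eq z∈Nu z∈D =
    x∈⁅y⁆⇒x≡y a (subst (z ∈_) eq (x∈p∩q⁺ (z∈Nu , z∈D)))

  private-intro : ∀ {D a u} → a ∈ N u → a ∈ D → (∀ z → z ∈ N u → z ∈ D → z ≡ a)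
    → N u ∩ D ≡ ⁅ a ⁆
  private-intro {D} {a} {u} a∈Nu a∈D unique = ⊆-antisym
    (λ {z} z∈ → subst (_∈ ⁅ a ⁆) (sym (unique z (p∩q⊆p (N u) D z∈) (p∩q⊆q (N u) D z∈))) (x∈⁅x⁆ a))
    (λ {z} z∈ → subst (_∈ N u ∩ D) (sym (x∈⁅y⁆⇒x≡y a z∈)) (x∈p∩q⁺ (a∈Nu , a∈D)))

  private-restrict : ∀ {A D a u} → A ⊆ D → a ∈ A → N u ∩ D ≡ ⁅ a ⁆ → N u ∩ A ≡ ⁅ a ⁆
  private-restrict {A} {D} {a} {u} A⊆D a∈A eq =
    private-intro a∈Nu a∈A (λ z z∈Nu z∈A → private-unique eq z∈Nu (A⊆D z∈A))
    where
      a∈Nu : a ∈ N u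
      a∈Nu = p∩q⊆p (N u) D (subst (a ∈_) (sym eq) (x∈⁅x⁆ a))

  module _ (C : IRChoice G) where
    open IRChoice C

    -- Every closed neighbourhood contains that of an irredundant vertex: choose
    -- an inclusion-minimal closed neighbourhood N[y] ⊆ N[v]; its representative in
    -- IR(G) has the same neighbourhood.
    irredundant-below : ∀ v → ∃[ w ] (w ∈ IR × N w ⊆ N v)
    irredundant-below v
      with minimal-subset (λ S → ∃[ y ] (N y ≡ S × S ⊆ N v))
             (λ S → any? (λ y → ≡-dec Bool._≟_ (N y) S ×-dec (S ⊆? N v)))
             (N v) (v , refl , (λ x → x))
    ... | _ , _ , (y , refl , Ny⊆Nv) , Ny-min
      with IR-cover y y-minimal
      where
        y-minimal : HasMinimalClosedNbhd G y
        y-minimal z Nz⊆Ny with N z ⊂? N y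
        ... | yes Nz⊂Ny = ⊥-elim (Ny-min (N z) Nz⊂Ny (z , refl , ⊆-trans Nz⊆Ny Ny⊆Nv))
        ... | no  Nz⊄Ny = ⊆-antisym Nz⊆Ny (λ {x} x∈Ny →
                decidable-stable (x ∈? N z) (λ x∉Nz → Nz⊄Ny (Nz⊆Ny , x , x∈Ny , x∉Nz)))
    ... | w , w∈IR , Nw≡Ny = w , w∈IR , λ x∈Nw → Ny⊆Nv (subst (_ ∈_) Nw≡Ny x∈Nw)

    dominating-via-IR : ∀ D → Dominates G D (_∈ IR) → DominatingSet G D
    dominating-via-IR D dom-IR v _ with irredundant-below v
    ... | w , w∈IR , Nw⊆Nv with dom-IR w w∈IR
    ... | d , d∈D , w∈Nd = d , d∈D , ∈N-sym (Nw⊆Nv (∈N-sym w∈Nd))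

    -- Every vertex of a minimal dominating set has an irredundant private
    -- neighbour: some v is dominated by a alone, and an irredundant w with
    -- N[w] ⊆ N[v] inherits this.
    minimal-private-IR : ∀ {D a} → MinimalDominatingSet G D → a ∈ D
      → ∃[ w ] (w ∈ IR × N w ∩ D ≡ ⁅ a ⁆)
    minimal-private-IR {D} {a} (D-dom , D-min) a∈D
      with undominated-witness {X = λ _ → Fin n} yes (D-min (D ∩ ∁ ⁅ a ⁆) D∖a⊂D)
      where
        D∖a⊂D : D ∩ ∁ ⁅ a ⁆ ⊂ D
        D∖a⊂D = p∩q⊆p D (∁ ⁅ a ⁆) , a , a∈D
              , (λ a∈D∖a → x∈∁p⇒x∉p (p∩q⊆q D (∁ ⁅ a ⁆) a∈D∖a) (x∈⁅x⁆ a))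
    ... | v , _ , v-only-by-a with irredundant-below v
    ... | w , w∈IR , Nw⊆Nv with D-dom w w
    ... | d , d∈D , w∈Nd = w , w∈IR , private-intro a∈Nw a∈D only-a
      where
        only-a : ∀ z → z ∈ N w → z ∈ D → z ≡ a
        only-a z z∈Nw z∈D with z ≟ a
        ... | yes z≡a = z≡a
        ... | no  z≢a = ⊥-elim (v-only-by-a
                (z , x∈p∩q⁺ (z∈D , x∉p⇒x∈∁p (λ z∈a → z≢a (x∈⁅y⁆⇒x≡y a z∈a))) , ∈N-sym (Nw⊆Nv z∈Nw)))
        a∈Nw : a ∈ N w
        a∈Nw = subst (_∈ N w) (only-a d (∈N-sym w∈Nd) d∈D) (∈N-sym w∈Nd)

    -- A private neighbour of a redundant vertex a with respect to D is not
    -- dominated by D ∩ IR(G), because a is its only neighbour in D.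
    private-not-dominated-by-IR : ∀ {D a w} → a ∉ IR → N w ∩ D ≡ ⁅ a ⁆
      → ¬ InClosedNbhdOf G (D ∩ IR) w
    private-not-dominated-by-IR {D} a∉IR eq (d , d∈D∩IR , w∈Nd) =
      a∉IR (subst (_∈ IR) (private-unique eq (∈N-sym w∈Nd) (p∩q⊆p D IR d∈D∩IR)) (p∩q⊆q D IR d∈D∩IR))

    module _ {A : Subset n} (A⊆RN : A ⊆ RN G C) where

      -- An irredundant vertex outside N(A) has no neighbour in A (it is not in A,
      -- as A is redundant).  So if D ⊆ A ∪ I dominates it, D ∩ I does.
      free-dominated-by-I : ∀ {D I u} → D ⊆ A ∪ I → u ∈ IR → ¬ InOpenNbhdOf G A u
        → InClosedNbhdOf G D u → InClosedNbhdOf G (D ∩ I) u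
      free-dominated-by-I {D} {I} D⊆A∪I u∈IR u∉N⟨A⟩ (d , d∈D , u∈Nd)
        with x∈p∪q⁻ A I (D⊆A∪I d∈D)
      ... | inj₂ d∈I = d , x∈p∩q⁺ (d∈D , d∈I) , u∈Nd
      ... | inj₁ d∈A = ⊥-elim (u∉N⟨A⟩ ((d , d∈A , u∈Nd) , λ u∈A → x∈∁p⇒x∉p (A⊆RN u∈A) u∈IR))

      private-dominated : ∀ {D I a u} → D ⊆ A ∪ I → PrivIR G C A a u
        → InClosedNbhdOf G D u → a ∈ D ⊎ InClosedNbhdOf G I u
      private-dominated {D} {I} D⊆A∪I (_ , private-eq) (d , d∈D , u∈Nd)
        with x∈p∪q⁻ A I (D⊆A∪I d∈D)
      ... | inj₁ d∈A = inj₁ (subst (_∈ D) (private-unique private-eq (∈N-sym u∈Nd) d∈A) d∈D)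
      ... | inj₂ d∈I = inj₂ (d , d∈I , u∈Nd)

      good-dominating : ∀ {I} → GoodI G C A I → DominatingSet G (A ∪ I)
      good-dominating {I} (_ , I-dom , _) = dominating-via-IR (A ∪ I) dom-IR
        where
          dom-IR : Dominates G (A ∪ I) (_∈ IR)
          dom-IR u u∈IR with dominated? A u
          ... | yes u-by-A = dominated-mono (x∈p∪q⁺ ∘ inj₁) u-by-A
          ... | no  u-not-by-A =
            dominated-mono (x∈p∪q⁺ ∘ inj₂) (I-dom u (u∈IR , λ u∈N⟨A⟩ → u-not-by-A (proj₁ u∈N⟨A⟩)))

      necessity : InDRN G C A
        → (∀ a → a ∈ A → ∃[ u ] PrivIR G C A a u) × ∃[ I ] GoodI G C A I
      necessity (D , D-mindom , D∩RN≡A) =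
        (λ a a∈A → let w , w∈IR , eq , _ = private-of a a∈A in w , w∈IR , eq)
        , D ∩ IR , p∩q⊆q D IR , I-dom , I-misses-private
        where
          A⊆D : A ⊆ D
          A⊆D a∈A = p∩q⊆p D (RN G C) (subst (_ ∈_) (sym D∩RN≡A) a∈A)

          D⊆A∪IR : D ⊆ A ∪ IR
          D⊆A∪IR {x} x∈D with x ∈? IR
          ... | yes x∈IR = x∈p∪q⁺ (inj₂ x∈IR)
          ... | no  x∉IR = x∈p∪q⁺ (inj₁ (subst (x ∈_) D∩RN≡A (x∈p∩q⁺ (x∈D , x∉p⇒x∈∁p x∉IR))))

          private-of : ∀ a → a ∈ A
            → ∃[ w ] (w ∈ IR × N w ∩ A ≡ ⁅ a ⁆ × ¬ InClosedNbhdOf G (D ∩ IR) w)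
          private-of a a∈A =
            let w , w∈IR , eq = minimal-private-IR D-mindom (A⊆D a∈A)
            in  w , w∈IR , private-restrict A⊆D a∈A eq
                , private-not-dominated-by-IR (x∈∁p⇒x∉p (A⊆RN a∈A)) eq

          I-dom : Dominates G (D ∩ IR) (λ u → u ∈ IR × ¬ InOpenNbhdOf G A u)
          I-dom u (u∈IR , u∉N⟨A⟩) = free-dominated-by-I D⊆A∪IR u∈IR u∉N⟨A⟩ (proj₁ D-mindom u u)

          I-misses-private : ∀ a → a ∈ A → ¬ Dominates G (D ∩ IR) (PrivIR G C A a)
          I-misses-private a a∈A dom =
            let w , w∈IR , eq , not-dom = private-of a a∈A in not-dom (dom w (w∈IR , eq))

      -- A witness I yields a minimal dominating D ⊆ A ∪ I, and D ∩ RN(G) = A since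
      -- each a ∈ A is needed to dominate a private neighbour that I misses.
      sufficiency : ∀ {I} → GoodI G C A I → InDRN G C A
      sufficiency {I} good@(I⊆IR , _ , I-misses-private)
        with minimal-subset (DominatingSet G) dominating? (A ∪ I) (good-dominating good)
      ... | D , D⊆A∪I , D-dom , D-min = D , (D-dom , D-min) , ⊆-antisym D∩RN⊆A A⊆D∩RN
        where
          private? : ∀ a u → Dec (PrivIR G C A a u)
          private? a u = (u ∈? IR) ×-dec ≡-dec Bool._≟_ (N u ∩ A) ⁅ a ⁆

          D∩RN⊆A : D ∩ RN G C ⊆ A
          D∩RN⊆A {z} z∈ with x∈p∪q⁻ A I (D⊆A∪I (p∩q⊆p D (RN G C) z∈))
          ... | inj₁ z∈A = z∈A
          ... | inj₂ z∈I = ⊥-elim (x∈∁p⇒x∉p (p∩q⊆q D (RN G C) z∈) (I⊆IR z∈I))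

          A⊆D∩RN : A ⊆ D ∩ RN G C
          A⊆D∩RN {a} a∈A
            with undominated-witness (private? a) (I-misses-private a a∈A)
          ... | u , u-private , u-not-by-I
            with private-dominated D⊆A∪I u-private (D-dom u u)
          ... | inj₁ a∈D  = x∈p∩q⁺ (a∈D , A⊆RN a∈A)
          ... | inj₂ u-by-I = ⊥-elim (u-not-by-I u-by-I)

      minimality : ∀ I → MinimalGoodI G C A I → MinimalDominatingSet G (A ∪ I)
      minimality I (good@(I⊆IR , _ , I-misses-private) , I-min) =
        good-dominating good , no-smaller
        where
          no-smaller : ∀ D′ → D′ ⊂ A ∪ I → ¬ DominatingSet G D′
          no-smaller D′ (D′⊆A∪I , x , x∈A∪I , x∉D′) D′-dom with x∈p∪q⁻ A I x∈A∪I
          -- Without x ∈ A, I would dominate the private neighbours of x.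
          ... | inj₁ x∈A = I-misses-private x x∈A λ u u-private →
            case private-dominated D′⊆A∪I u-private (D′-dom u u) of λ where
              (inj₁ x∈D′) → ⊥-elim (x∉D′ x∈D′)
              (inj₂ u-by-I) → u-by-I
          -- Without x ∈ I, the proper subset D′ ∩ I of I would be a witness.
          ... | inj₂ x∈I = I-min (D′ ∩ I)
            (p∩q⊆q D′ I , x , x∈I , λ x∈D′∩I → x∉D′ (p∩q⊆p D′ I x∈D′∩I))
            ( (λ z∈ → I⊆IR (p∩q⊆q D′ I z∈))
            , (λ u (u∈IR , u∉N⟨A⟩) → free-dominated-by-I D′⊆A∪I u∈IR u∉N⟨A⟩ (D′-dom u u))
            , (λ a a∈A dom → I-misses-private a a∈A λ u u-private →
                 dominated-mono (p∩q⊆q D′ I) (dom u u-private)))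

corollary3 : ∀ {n} (G : Graph n) (C : IRChoice G) (A : Subset n)
    → A ⊆ RN G C
    → (InDRN G C A
        ⇔ ((∀ a → a ∈ A → ∃[ u ] PrivIR G C A a u)
           × ∃[ I ] GoodI G C A I))
      × (∀ I → MinimalGoodI G C A I → MinimalDominatingSet G (A ∪ I))
corollary3 G C A A⊆RN =
    mk⇔ (necessity G C A⊆RN) (λ (_ , _ , good) → sufficiency G C A⊆RN good)
  , minimality G C A⊆RN
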